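{- Let $\mathcal{T}$ be any tree of nodes over an $N\times M$ matrix. Then there exists a submatrix $B$ such that every set $R$ of nodes of $\mathcal{T}$ with $\bigcup_{n\in R}n=B$ satisfies $|R|\ge \frac{NM}{N+M}$.
   Context: A submatrix $[x_0,x_1][y_0,y_1]$ is the set of positions $(x,y)$ with $x_0\le x\le x_1$, $y_0\le y\le y_1$, where $0\le x<N$, $0\le y<M$. A node is a set of positions of the matrix. A set of nodes over the matrix is a tree if it is organized as a rooted tree satisfying: (1) the root node covers all positions; (2) every node covering more than one position has at least two children, each covering at least one position; (3) every node covering exactly one position has no children; (4) all children of the same node are mutually disjoint; (5) the union of the children of a node $n$ equals $n$. Nodes need not cover submatrices. -}

module Defs where

open import Data.Nat using (ℕ; _≤_; _<_; _+_)
open import Data.Fin using (Fin; toℕ)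
open import Data.Bool using (Bool; true)
open import Data.Vec using (Vec; lookup; replicate)
open import Data.List using (List; []; _∷_; map; length; sum; _++_)
open import Data.List.Relation.Unary.All using (All)
open import Data.List.Relation.Unary.Any using (Any)
open import Data.List.Relation.Unary.AllPairs using (AllPairs)
open import Data.Product using (Σ; _×_; _,_)
open import Relation.Binary.PropositionalEquality using (_≡_; _≢_)
open import Relation.Nullary using (¬_)
import Data.Fin.Subset as Sub
import Data.Vec as V

Pos : ℕ → ℕ → Set
Pos N M = Fin N × Fin M

-- A node: a set of positions, represented as an N × M Boolean matrix.
Node : ℕ → ℕ → Set
Node N M = Vec (Vec Bool M) N

_∋_ : ∀ {N M} → Node N M → Pos N M → Set
S ∋ (x , y) = lookup (lookup S x) y ≡ true

size : ∀ {N M} → Node N M → ℕ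
size S = V.sum (V.map Sub.∣_∣ S)

full : ∀ {N M} → Node N M
full = replicate _ (replicate _ true)

Disjoint : ∀ {N M} → Node N M → Node N M → Set
Disjoint a b = ∀ p → ¬ (a ∋ p × b ∋ p)

UnionIs : ∀ {N M} → List (Node N M) → Node N M → Set
UnionIs R S = ∀ p → (S ∋ p → Any (_∋ p) R) × (Any (_∋ p) R → S ∋ p)

data RTree (A : Set) : Set where
  rnode : A → List (RTree A) → RTree A

label : ∀ {A} → RTree A → A
label (rnode a _) = a

data WF {N M : ℕ} : RTree (Node N M) → Set where
  wf : ∀ {S : Node N M} {cs : List (RTree (Node N M))} →
       (2 ≤ size S → (2 ≤ length cs) × All (λ c → 1 ≤ size (label c)) cs) →
       (size S ≡ 1 → cs ≡ []) →
       AllPairs Disjoint (map label cs) →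
       (cs ≢ [] → UnionIs (map label cs) S) →
       All WF cs →
       WF (rnode S cs)

IsTree : ∀ {N M} → RTree (Node N M) → Set
IsTree T = (label T ≡ full) × WF T

mutual
  nodes : ∀ {A} → RTree A → List A
  nodes (rnode a cs) = a ∷ nodesL cs

  nodesL : ∀ {A} → List (RTree A) → List A
  nodesL [] = []
  nodesL (c ∷ cs) = nodes c ++ nodesL cs

record Submatrix (N M : ℕ) : Set where
  field
    x0 x1 y0 y1 : ℕ
    x0≤x1 : x0 ≤ x1
    x1<N : x1 < N
    y0≤y1 : y0 ≤ y1
    y1<M : y1 < M

_∈ₛ_ : ∀ {N M} → Pos N M → Submatrix N M → Set
(x , y) ∈ₛ B = (x0 ≤ toℕ x) × (toℕ x ≤ x1) × (y0 ≤ toℕ y) × (toℕ y ≤ y1)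
  where open Submatrix B

-- The nodes of a tree form a laminar family. Call a cell c isolated in a region Q if the only
-- node that contains c and lies inside Q is {c} itself. If c were isolated neither in its row
-- nor in its column, there would be a node inside the row and a node inside the column, both
-- containing c and a second cell; by laminarity one contains the other, and the smaller one
-- then lies in row ∩ column = {c}. Hence every cell is isolated in its row or in its column,
-- and the N + M lines together have at least N M isolated incidences, so some line B has at
-- least N M / (N + M) cells isolated in B. A family R of nodes with union B must contain, for
-- each such cell c, a node inside B containing c, which can only be {c}.
module Submission where

open import Defs
open import Data.Bool as Bool using (true)
open import Data.Empty using (⊥; ⊥-elim)
open import Data.Fin using (Fin; zero; suc; toℕ)
import Data.Fin.Properties as Fin
open import Data.List using (List; []; _∷_; map; length)
open import Data.List.Membership.Propositional using (_∈_; find; lose)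
open import Data.List.Membership.Propositional.Properties using (∈-++⁻)
open import Data.List.Relation.Unary.All as All using (All; _∷_)
open import Data.List.Relation.Unary.AllPairs using (AllPairs; _∷_)
open import Data.List.Relation.Unary.Any as Any using (Any; here; there)
open import Data.List.Relation.Unary.Any.Properties using (¬Any[]; map⁺)
open import Data.List.Relation.Unary.Unique.Propositional using (Unique)
open import Data.Nat using (ℕ; zero; suc; _≤_; _<_; _+_; _*_; z≤n; s≤s)
open import Data.Nat.Properties
open import Algebra.Properties.Semiring.Sum +-*-semiring
  using (sum-syntax; sum-cong-≗; ∑-distrib-+; ∑-comm; *-distribʳ-sum; sum-replicate-zero)
open import Algebra.Properties.CommutativeSemigroup +-commutativeSemigroup using (interchange; x∙yz≈y∙xz)
open import Data.Product using (Σ; ∃; _×_; _,_; proj₁; proj₂)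
open import Data.Product.Properties using (≡-dec; ×-≡,≡→≡)
open import Data.Sum using (_⊎_; inj₁; inj₂; [_,_]; fromInj₁)
open import Data.Unit using (tt)
open import Data.Vec using (lookup)
open import Function using (_∘_; _∘₂_; Injective)
open import Relation.Binary.PropositionalEquality using (_≡_; _≢_; refl; sym; trans; cong; cong₂)
open import Relation.Nullary using (Dec; yes; no; ¬_)
open import Relation.Nullary.Decidable using (map′; _×-dec_; _→-dec_; decidable-stable)
open import Relation.Unary using (Decidable)

private
  variable
    N M K : ℕ
    A : Set

∑-mono-≤ : {f g : Fin K → ℕ} → (∀ i → f i ≤ g i) → ∑[ i < K ] f i ≤ ∑[ i < K ] g i
∑-mono-≤ {zero}  f≤g = z≤n
∑-mono-≤ {suc K} f≤g = +-mono-≤ (f≤g zero) (∑-mono-≤ (f≤g ∘ suc))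

∑-const : ∀ K c → ∑[ i < K ] c ≡ K * c
∑-const zero    c = refl
∑-const (suc K) c = cong (c +_) (∑-const K c)

∑-<-bound : ∀ K {f : Fin K → ℕ} {b} → (∀ i → f i < b) → K + ∑[ i < K ] f i ≤ K * b
∑-<-bound zero    f<b = z≤n
∑-<-bound (suc K) {f} {b} f<b = begin
  suc K + (f zero + ∑[ i < K ] f (suc i))  ≡⟨ cong suc (x∙yz≈y∙xz K (f zero) _) ⟩
  suc (f zero) + (K + ∑[ i < K ] f (suc i)) ≤⟨ +-mono-≤ (f<b zero) (∑-<-bound K (f<b ∘ suc)) ⟩
  b + K * b                                 ∎
  where open ≤-Reasoning

𝟙 : Dec A → ℕ
𝟙 (yes _) = 1
𝟙 (no _)  = 0

𝟙-mono : {B : Set} → (A → B) → (a : Dec A) (b : Dec B) → 𝟙 a ≤ 𝟙 b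
𝟙-mono f (yes a) (yes b) = ≤-refl
𝟙-mono f (yes a) (no ¬b) = ⊥-elim (¬b (f a))
𝟙-mono f (no ¬a) b       = z≤n

𝟙-⊎ : {B C : Set} → (A → B ⊎ C) → (a : Dec A) (b : Dec B) (c : Dec C) → 𝟙 a ≤ 𝟙 b + 𝟙 c
𝟙-⊎ f (no ¬a) b c = z≤n
𝟙-⊎ f (yes a) b c with f a
... | inj₁ x = ≤-trans (𝟙-mono (λ _ → x) (yes a) b) (m≤m+n _ _)
... | inj₂ y = ≤-trans (𝟙-mono (λ _ → y) (yes a) c) (m≤n+m _ _)

count : {P : Fin K → Set} → Decidable P → ℕ
count {K} P? = ∑[ i < K ] 𝟙 (P? i)

count-mono : {P Q : Fin K → Set} (P? : Decidable P) (Q? : Decidable Q) →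
             (∀ i → P i → Q i) → count P? ≤ count Q?
count-mono P? Q? P⇒Q = ∑-mono-≤ (λ i → 𝟙-mono (P⇒Q i) (P? i) (Q? i))

count-⊎ : {P Q S : Fin K → Set} (P? : Decidable P) (Q? : Decidable Q) (S? : Decidable S) →
          (∀ i → P i → Q i ⊎ S i) → count P? ≤ count Q? + count S?
count-⊎ {K} P? Q? S? P⇒Q⊎S = begin
  count P?                                      ≤⟨ ∑-mono-≤ (λ i → 𝟙-⊎ (P⇒Q⊎S i) (P? i) (Q? i) (S? i)) ⟩
  ∑[ i < K ] (𝟙 (Q? i) + 𝟙 (S? i))              ≡⟨ ∑-distrib-+ (λ i → 𝟙 (Q? i)) (λ i → 𝟙 (S? i)) ⟩
  count Q? + count S?                           ∎
  where open ≤-Reasoning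

count-≤-1 : {P : Fin K → Set} (P? : Decidable P) → (∀ {i j} → P i → P j → i ≡ j) → count P? ≤ 1
count-≤-1 {zero}  P? unique = z≤n
count-≤-1 {suc K} P? unique with P? zero
... | yes p₀ = +-mono-≤ ≤-refl (begin
    count (P? ∘ suc)           ≤⟨ count-mono (P? ∘ suc) (λ _ → no λ ()) (λ i → Fin.0≢1+n ∘ unique p₀) ⟩
    ∑[ i < K ] 0               ≡⟨ sum-replicate-zero K ⟩
    0                          ∎)
  where open ≤-Reasoning
... | no _   = count-≤-1 (P? ∘ suc) (Fin.suc-injective ∘₂ unique)

count-witnessed-≤-length : {W : A → Fin K → Set} (W? : ∀ a → Decidable (W a)) →
  (∀ a {i j} → W a i → W a j → i ≡ j) →
  (R : List A) → count (λ i → Any.any? (λ a → W? a i) R) ≤ length R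
count-witnessed-≤-length {K = K} W? unique [] = ≤-reflexive (sum-replicate-zero K)
count-witnessed-≤-length W? unique (a ∷ R) =
  ≤-trans (count-⊎ _ (W? a) _ (λ i → Any.toSum))
          (+-mono-≤ (count-≤-1 (W? a) (unique a)) (count-witnessed-≤-length W? unique R))

_≟ₚ_ : (p q : Pos N M) → Dec (p ≡ q)
_≟ₚ_ = ≡-dec Fin._≟_ Fin._≟_

all-positions? : {P : Pos N M → Set} → Decidable P → Dec (∀ p → P p)
all-positions? P? = map′ (λ all x,y → all (proj₁ x,y) (proj₂ x,y)) (λ all x y → all (x , y))
                         (Fin.all? λ x → Fin.all? λ y → P? (x , y))

_∋?_ : (n : Node N M) → Decidable (n ∋_)
n ∋? (x , y) = lookup (lookup n x) y Bool.≟ true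

_⊆_ : Node N M → (Pos N M → Set) → Set
n ⊆ Q = ∀ p → n ∋ p → Q p

_⊆?_ : (n : Node N M) {Q : Pos N M → Set} → Decidable Q → Dec (n ⊆ Q)
n ⊆? Q? = all-positions? (λ p → n ∋? p →-dec Q? p)

Laminar : List (Node N M) → Set
Laminar L = ∀ {a b p} → a ∈ L → b ∈ L → a ∋ p → b ∋ p → a ⊆ (b ∋_) ⊎ b ⊆ (a ∋_)

Isolated : List (Node N M) → (Pos N M → Set) → Pos N M → Set
Isolated L Q c = All (λ n → n ∋ c → n ⊆ Q → n ⊆ (_≡ c)) L

isolated? : (L : List (Node N M)) {Q : Pos N M → Set} → Decidable Q → Decidable (Isolated L Q)
isolated? L Q? c = All.all? (λ n → n ∋? c →-dec n ⊆? Q? →-dec n ⊆? (_≟ₚ c)) L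

isolated-in-one-of : {L : List (Node N M)} {Q₁ Q₂ : Pos N M → Set} {c : Pos N M} →
  Laminar L → Decidable Q₁ → (∀ p → Q₁ p → Q₂ p → p ≡ c) →
  Isolated L Q₁ c ⊎ Isolated L Q₂ c
isolated-in-one-of {L = L} {Q₁} {Q₂} {c} laminar Q₁? meet with isolated? L Q₁? c
... | yes iso₁ = inj₁ iso₁
... | no ¬iso₁ = inj₂ (All.tabulate λ b∈L c∈b b⊆Q₂ p p∈b → decidable-stable (p ≟ₚ c) λ p≢c →
        ¬iso₁ (All.tabulate λ a∈L c∈a a⊆Q₁ →
          fromInj₁ (λ b⊆c → ⊥-elim (p≢c (b⊆c p p∈b))) (one-inside-meet a∈L b∈L c∈a c∈b a⊆Q₁ b⊆Q₂)))
  where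
  one-inside-meet : ∀ {a b} → a ∈ L → b ∈ L → a ∋ c → b ∋ c → a ⊆ Q₁ → b ⊆ Q₂ →
                    a ⊆ (_≡ c) ⊎ b ⊆ (_≡ c)
  one-inside-meet a∈L b∈L c∈a c∈b a⊆Q₁ b⊆Q₂ with laminar a∈L b∈L c∈a c∈b
  ... | inj₁ a⊆b = inj₁ λ q q∈a → meet q (a⊆Q₁ q q∈a) (b⊆Q₂ q (a⊆b q q∈a))
  ... | inj₂ b⊆a = inj₂ λ q q∈b → meet q (a⊆Q₁ q (b⊆a q q∈b)) (b⊆Q₂ q q∈b)

CoversExactly : List (Node N M) → (Pos N M → Set) → Set
CoversExactly R Q = ∀ p → (Q p → Any (_∋ p) R) × (Any (_∋ p) R → Q p)

isolated-cells-≤-length : {L R : List (Node N M)} {Q : Pos N M → Set} (Q? : Decidable Q) →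
  All (_∈ L) R → CoversExactly R Q →
  (cell : Fin K → Pos N M) → Injective _≡_ _≡_ cell → (∀ i → Q (cell i)) →
  count (isolated? L Q? ∘ cell) ≤ length R
isolated-cells-≤-length {L = L} {R} {Q} Q? R⊆L cover cell cell-injective cell∈Q = begin
  count (isolated? L Q? ∘ cell)                    ≤⟨ count-mono _ _ witnessed ⟩
  count (λ i → Any.any? (λ n → singleton? n i) R) ≤⟨ count-witnessed-≤-length singleton? unique R ⟩
  length R                                         ∎
  where
  open ≤-Reasoning
  IsSingleton : Node _ _ → Fin _ → Set
  IsSingleton n i = n ∋ cell i × n ⊆ (_≡ cell i)

  singleton? : ∀ n → Decidable (IsSingleton n)
  singleton? n i = n ∋? cell i ×-dec n ⊆? (_≟ₚ cell i)

  unique : ∀ n {i j} → IsSingleton n i → IsSingleton n j → i ≡ j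
  unique n (_ , n⊆i) (j∈n , _) = cell-injective (sym (n⊆i _ j∈n))

  witnessed : ∀ i → Isolated L Q (cell i) → Any (λ n → IsSingleton n i) R
  witnessed i iso with find (proj₁ (cover (cell i)) (cell∈Q i))
  ... | n , n∈R , i∈n = lose n∈R (i∈n , All.lookup iso (All.lookup R⊆L n∈R) i∈n n⊆Q)
    where
    n⊆Q : n ⊆ Q
    n⊆Q p p∈n = proj₂ (cover p) (lose n∈R p∈n)

mutual
  ∈-nodes⇒⊆-label : ∀ {t : RTree (Node N M)} {n} → WF t → n ∈ nodes t → n ⊆ (label t ∋_)
  ∈-nodes⇒⊆-label (wf _ _ _ _ _) (here refl) p p∈n = p∈n
  ∈-nodes⇒⊆-label {n = n} (wf {cs = cs} _ _ _ union wfs) (there n∈cs) p p∈n =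
    proj₂ (union cs≢[] p) (map⁺ (Any.map (λ n⊆c → n⊆c p p∈n) below))
    where
    below : Any (λ c → n ⊆ (label c ∋_)) cs
    below = ∈-nodesL⇒⊆-child wfs n∈cs
    cs≢[] : cs ≢ []
    cs≢[] refl = ¬Any[] below

  ∈-nodesL⇒⊆-child : ∀ {cs : List (RTree (Node N M))} {n} → All WF cs → n ∈ nodesL cs →
                     Any (λ c → n ⊆ (label c ∋_)) cs
  ∈-nodesL⇒⊆-child {cs = c ∷ _} (w ∷ ws) n∈ with ∈-++⁻ (nodes c) n∈
  ... | inj₁ n∈c  = here (∈-nodes⇒⊆-label w n∈c)
  ... | inj₂ n∈cs = there (∈-nodesL⇒⊆-child ws n∈cs)

disjoint-below : ∀ {a n p} {cs : List (RTree (Node N M))} → All (Disjoint a) (map label cs) →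
                 Any (λ c → n ⊆ (label c ∋_)) cs → n ∋ p → ¬ a ∋ p
disjoint-below {n = n} d below p∈n p∈a =
  All.lookupWith {Q = λ c → n ⊆ (c ∋_)} {R = λ _ → ⊥}
                 (λ disj n⊆c → disj _ (p∈a , n⊆c _ p∈n)) d (map⁺ below)

mutual
  nodes-laminar : ∀ {t : RTree (Node N M)} → WF t → Laminar (nodes t)
  nodes-laminar w@(wf _ _ _ _ _) (here refl) b∈t _ _ = inj₂ (∈-nodes⇒⊆-label w b∈t)
  nodes-laminar w@(wf _ _ _ _ _) (there a∈cs) (here refl) _ _ = inj₁ (∈-nodes⇒⊆-label w (there a∈cs))
  nodes-laminar (wf _ _ disjoint _ wfs) (there a∈cs) (there b∈cs) = nodesL-laminar wfs disjoint a∈cs b∈cs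

  nodesL-laminar : ∀ {cs : List (RTree (Node N M))} → All WF cs → AllPairs Disjoint (map label cs) →
                   Laminar (nodesL cs)
  nodesL-laminar {cs = c ∷ cs} (w ∷ ws) (d ∷ ds) {a} {b} {p} a∈ b∈ p∈a p∈b
    with ∈-++⁻ (nodes c) a∈ | ∈-++⁻ (nodes c) b∈
  ... | inj₁ a∈c  | inj₁ b∈c  = nodes-laminar w a∈c b∈c p∈a p∈b
  ... | inj₂ a∈cs | inj₂ b∈cs = nodesL-laminar ws ds a∈cs b∈cs p∈a p∈b
  ... | inj₁ a∈c  | inj₂ b∈cs = ⊥-elim (disjoint-below {a = label c} {n = b} {p} d
                                  (∈-nodesL⇒⊆-child ws b∈cs) p∈b (∈-nodes⇒⊆-label w a∈c p p∈a))
  ... | inj₂ a∈cs | inj₁ b∈c  = ⊥-elim (disjoint-below {a = label c} {n = a} {p} d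
                                  (∈-nodesL⇒⊆-child ws a∈cs) p∈a (∈-nodes⇒⊆-label w b∈c p p∈b))

∑∑-≥-area : (f g : Fin N → Fin M → ℕ) → (∀ x y → 1 ≤ f x y + g x y) →
            N * M ≤ ∑[ x < N ] ∑[ y < M ] f x y + ∑[ y < M ] ∑[ x < N ] g x y
∑∑-≥-area {N} {M} f g covered = begin
  N * M                                                       ≡⟨ cong (N *_) (trans (∑-const M 1) (*-identityʳ M)) ⟨
  N * ∑[ y < M ] 1                                            ≡⟨ ∑-const N _ ⟨
  ∑[ x < N ] ∑[ y < M ] 1                                     ≤⟨ ∑-mono-≤ (λ x → ∑-mono-≤ (covered x)) ⟩
  ∑[ x < N ] ∑[ y < M ] (f x y + g x y)                       ≡⟨ sum-cong-≗ (λ x → ∑-distrib-+ (f x) (g x)) ⟩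
  ∑[ x < N ] (∑[ y < M ] f x y + ∑[ y < M ] g x y)            ≡⟨ ∑-distrib-+ (λ x → ∑[ y < M ] f x y) (λ x → ∑[ y < M ] g x y) ⟩
  ∑[ x < N ] ∑[ y < M ] f x y + ∑[ x < N ] ∑[ y < M ] g x y   ≡⟨ cong (_ +_) (∑-comm g) ⟩
  ∑[ x < N ] ∑[ y < M ] f x y + ∑[ y < M ] ∑[ x < N ] g x y   ∎
  where open ≤-Reasoning

some-line-≥-average : (f : Fin N → ℕ) (g : Fin M → ℕ) {T : ℕ} → 1 ≤ N + M →
                      T ≤ ∑[ x < N ] f x + ∑[ y < M ] g y →
                      (∃ λ x → T ≤ f x * (N + M)) ⊎ (∃ λ y → T ≤ g y * (N + M))
some-line-≥-average {N} {M} f g {T} 1≤L T≤S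
  with Fin.any? (λ x → T ≤? f x * (N + M)) | Fin.any? (λ y → T ≤? g y * (N + M))
... | yes big | _       = inj₁ big
... | no _    | yes big = inj₂ big
... | no ¬f   | no ¬g   = ⊥-elim (n≮n (S * L) (≤-trans (+-monoˡ-≤ (S * L) 1≤L) L+SL≤SL))
  where
  L = N + M
  S = ∑[ x < N ] f x + ∑[ y < M ] g y
  L+SL≤SL : L + S * L ≤ S * L
  L+SL≤SL = begin
    L + S * L                                               ≡⟨ cong (L +_) (*-distribʳ-+ L (∑[ x < N ] f x) _) ⟩
    N + M + (∑[ x < N ] f x * L + ∑[ y < M ] g y * L)       ≡⟨ cong₂ (λ u v → N + M + (u + v)) (*-distribʳ-sum L f) (*-distribʳ-sum L g) ⟩
    N + M + (∑[ x < N ] (f x * L) + ∑[ y < M ] (g y * L))   ≡⟨ interchange N M _ _ ⟩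
    (N + ∑[ x < N ] (f x * L)) + (M + ∑[ y < M ] (g y * L)) ≤⟨ +-mono-≤ (∑-<-bound N (λ x → ≰⇒> (¬f ∘ (x ,_))))
                                                                         (∑-<-bound M (λ y → ≰⇒> (¬g ∘ (y ,_)))) ⟩
    N * T + M * T                                           ≡⟨ *-distribʳ-+ T N M ⟨
    L * T                                                   ≤⟨ *-monoʳ-≤ L T≤S ⟩
    L * S                                                   ≡⟨ *-comm L S ⟩
    S * L                                                   ∎
    where open ≤-Reasoning

_∈ₛ?_ : (p : Pos N M) (B : Submatrix N M) → Dec (p ∈ₛ B)
(x , y) ∈ₛ? B = x0 ≤? toℕ x ×-dec toℕ x ≤? x1 ×-dec y0 ≤? toℕ y ×-dec toℕ y ≤? y1
  where open Submatrix B

row : ∀ {m} → Fin N → Submatrix N (suc m)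
row {m = m} x = record { x0 = toℕ x ; x1 = toℕ x ; x0≤x1 = ≤-refl ; x1<N = Fin.toℕ<n x
                       ; y0 = 0 ; y1 = m ; y0≤y1 = z≤n ; y1<M = ≤-refl }

column : ∀ {n} → Fin M → Submatrix (suc n) M
column {n = n} y = record { x0 = 0 ; x1 = n ; x0≤x1 = z≤n ; x1<N = ≤-refl
                          ; y0 = toℕ y ; y1 = toℕ y ; y0≤y1 = ≤-refl ; y1<M = Fin.toℕ<n y }

∈-row : ∀ {m} (x : Fin N) (y : Fin (suc m)) → (x , y) ∈ₛ row x
∈-row x y = ≤-refl , ≤-refl , z≤n , Fin.toℕ≤pred[n] y

∈-column : ∀ {n} (x : Fin (suc n)) (y : Fin M) → (x , y) ∈ₛ column y
∈-column x y = z≤n , Fin.toℕ≤pred[n] x , ≤-refl , ≤-refl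

row-∩-column : ∀ {n m} {x : Fin (suc n)} {y : Fin (suc m)} (p : Pos (suc n) (suc m)) →
               p ∈ₛ row x → p ∈ₛ column y → p ≡ (x , y)
row-∩-column _ (x≤ , ≤x , _) (_ , _ , y≤ , ≤y) =
  ×-≡,≡→≡ (Fin.toℕ-injective (≤-antisym ≤x x≤) , Fin.toℕ-injective (≤-antisym ≤y y≤))

theorem3 : (N M : ℕ) → 1 ≤ N → 1 ≤ M →
    (T : RTree (Node N M)) → IsTree T →
    Σ (Submatrix N M) λ B →
    (R : List (Node N M)) → Unique R → All (_∈ nodes T) R →
    (∀ p → (p ∈ₛ B → Any (_∋ p) R) × (Any (_∋ p) R → p ∈ₛ B)) →
    N * M ≤ length R * (N + M)
theorem3 N@(suc _) M@(suc _) _ _ T (_ , wfT) =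
  [ (λ (x , big) → row x    , bound-from-line (row x) (x ,_) (cong proj₂) (∈-row x) big)
  , (λ (y , big) → column y , bound-from-line (column y) (_, y) (cong proj₁) (λ x → ∈-column x y) big)
  ] (some-line-≥-average rowCount columnCount (s≤s z≤n) incidences)
  where
  isolated-in-row? : ∀ x y → Dec (Isolated (nodes T) (_∈ₛ row x) (x , y))
  isolated-in-row? x y = isolated? (nodes T) (_∈ₛ? row x) (x , y)
  isolated-in-column? : ∀ x y → Dec (Isolated (nodes T) (_∈ₛ column y) (x , y))
  isolated-in-column? x y = isolated? (nodes T) (_∈ₛ? column y) (x , y)

  rowCount : Fin N → ℕ
  rowCount x = count (isolated-in-row? x)
  columnCount : Fin M → ℕ
  columnCount y = count (λ x → isolated-in-column? x y)

  incidences : N * M ≤ ∑[ x < N ] rowCount x + ∑[ y < M ] columnCount y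
  incidences = ∑∑-≥-area (λ x y → 𝟙 (isolated-in-row? x y)) (λ x y → 𝟙 (isolated-in-column? x y))
    λ x y → 𝟙-⊎ (λ _ → isolated-in-one-of (nodes-laminar wfT) (_∈ₛ? row x) row-∩-column)
                (yes tt) (isolated-in-row? x y) (isolated-in-column? x y)

  -- Repetitions in R only make length R larger.
  bound-from-line : ∀ {K} (B : Submatrix N M) (cell : Fin K → Pos N M) → Injective _≡_ _≡_ cell →
    (∀ i → cell i ∈ₛ B) → N * M ≤ count (isolated? (nodes T) (_∈ₛ? B) ∘ cell) * (N + M) →
    (R : List (Node N M)) → Unique R → All (_∈ nodes T) R → CoversExactly R (_∈ₛ B) →
    N * M ≤ length R * (N + M)
  bound-from-line B cell cell-injective cell∈B big R _ R⊆T cover =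
    ≤-trans big (*-monoˡ-≤ (N + M) (isolated-cells-≤-length (_∈ₛ? B) R⊆T cover cell cell-injective cell∈B))
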